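{- For every integer $t\ge3$ there are infinitely many symplectic $t$-cores and infinitely many orthogonal $t$-cores.
   Context: A $t$-core is a partition from whose Young diagram no border strip (connected skew shape with no $2\times 2$ square) of size $t$ can be removed (equivalently, no cell has hook length divisible by $t$). A nonempty partition of rank $k$ (largest $k$ with $\lambda_k\ge k$) has Frobenius coordinates $(\alpha|\beta)$ with $\alpha_i=\lambda_i-i$, $\beta_i=\lambda'_i-i$ ($1\le i\le k$, $\lambda'$ the conjugate). A partition is symplectic if $\beta_i=\alpha_i+1$ for all $i$, and orthogonal if $\beta_i=\alpha_i-1$ for all $i$ (the empty partition is both). A symplectic (resp. orthogonal) $t$-core is a symplectic (resp. orthogonal) partition that is a $t$-core. -}

module Defs where

open import Data.Nat using (ℕ; zero; suc; _+_; _∸_; _≤_; _<_; _≤?_)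
open import Data.Nat.Divisibility using (_∣_)
open import Data.List using (List; []; _∷_; length; filter)
open import Data.List.Relation.Unary.All using (All)
open import Data.List.Relation.Unary.Linked using (Linked)
open import Data.Product using (_×_)
open import Data.Sum using (_⊎_)
open import Relation.Nullary using (¬_)
open import Relation.Binary.PropositionalEquality using (_≡_)

IsPartition : List ℕ → Set
IsPartition μ = All (0 <_) μ × Linked (λ a b → b ≤ a) μ

-- row μ i = μ_i (1-indexed; 0 for i beyond the length, and dummy 0 for i = 0)
row : List ℕ → ℕ → ℕ
row []       _             = 0
row (x ∷ xs) zero          = 0
row (x ∷ xs) (suc zero)    = x
row (x ∷ xs) (suc (suc n)) = row xs (suc n)

-- col μ j = μ'_j = #{ i : μ_i ≥ j }  (conjugate partition)
col : List ℕ → ℕ → ℕ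
col μ j = length (filter (λ x → j ≤? x) μ)

IsCell : List ℕ → ℕ → ℕ → Set
IsCell μ i j = 1 ≤ i × 1 ≤ j × j ≤ row μ i

hook : List ℕ → ℕ → ℕ → ℕ
hook μ i j = (row μ i ∸ j) + (col μ j ∸ i) + 1

IsCore : ℕ → List ℕ → Set
IsCore t μ = ∀ i j → IsCell μ i j → ¬ (t ∣ hook μ i j)

-- k is the rank (Durfee size): the largest k with μ_k ≥ k (k = 0 if none)
IsRank : List ℕ → ℕ → Set
IsRank μ k = (k ≡ 0 ⊎ k ≤ row μ k) × (∀ m → 1 ≤ m → m ≤ row μ m → m ≤ k)

frobα : List ℕ → ℕ → ℕ
frobα μ i = row μ i ∸ i

frobβ : List ℕ → ℕ → ℕ
frobβ μ i = col μ i ∸ i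

IsSymplectic : List ℕ → Set
IsSymplectic μ = ∀ k → IsRank μ k → ∀ i → 1 ≤ i → i ≤ k → frobβ μ i ≡ frobα μ i + 1

IsOrthogonal : List ℕ → Set
IsOrthogonal μ = ∀ k → IsRank μ k → ∀ i → 1 ≤ i → i ≤ k → frobα μ i ≡ frobβ μ i + 1

SymplecticCore : ℕ → List ℕ → Set
SymplecticCore t μ = IsPartition μ × IsSymplectic μ × IsCore t μ

OrthogonalCore : ℕ → List ℕ → Set
OrthogonalCore t μ = IsPartition μ × IsOrthogonal μ × IsCore t μ

{-# OPTIONS --safe #-}
-- With t = c + 1, prepend to a nonempty partition μ a new first row and first column, each t
-- cells longer than those of μ. The hooks of the result ν are those of μ (shifted one step down
-- the diagonal), the hooks of μ's first row and column increased by t, the corner hook of μ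
-- increased by 2t, and the hooks 1, …, t − 1 of the new cells past μ's first row and column.
-- So ν is a t-core whenever μ is, and every βᵢ − αᵢ is preserved. For t ≥ 3, iterating from
-- the symplectic t-core (1,1) and the orthogonal t-core (2) yields arbitrarily long ones.
module Submission where

open import Defs
open import Data.Nat using (ℕ; zero; suc; _+_; _∸_; _≤_; _<_; _≥_; _≤?_; z≤n; s≤s; s≤s⁻¹)
open import Data.Nat.Properties
open import Data.Nat.Divisibility using (_∣_; _∤_; >⇒∤; ∣-refl; ∣m∣n⇒∣m+n; ∣m+n∣m⇒∣n)
open import Data.Nat.GeneralisedArithmetic using (iterate)
open import Data.Nat.ListAction using (sum)
open import Data.Nat.Tactic.RingSolver using (solve-∀)
open import Data.List using (List; []; _∷_; length; map; _++_; replicate; filter)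
open import Data.List.Properties
  using (length-++; length-map; length-replicate; filter-++; filter-all; filter-none; filter-accept; filter-reject)
open import Data.List.Membership.Propositional using (_∈_; _∉_)
open import Data.List.Relation.Unary.All as All using (All; []; _∷_)
open import Data.List.Relation.Unary.All.Properties using (replicate⁺; map⁺; ++⁺)
open import Data.List.Relation.Unary.Any using (here; there)
open import Data.List.Relation.Unary.Linked using (Linked; []; [-]; _∷_; tail)
open import Data.List.Relation.Unary.Linked.Properties using (Linked⇒All)
open import Data.Product using (_×_; _,_; ∃-syntax)
open import Data.Sum using (inj₁; inj₂)
open import Data.Empty using (⊥-elim)
open import Function using (flip)
open import Relation.Nullary using (¬_; yes; no)
open import Relation.Binary.PropositionalEquality
  using (_≡_; refl; sym; trans; cong; cong₂; subst; subst₂; module ≡-Reasoning)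

head-bounds : ∀ {h r} → Linked _≥_ (h ∷ r) → All (_≤ h) (h ∷ r)
head-bounds = Linked⇒All (λ y≤x z≤y → ≤-trans z≤y y≤x) ≤-refl

row-≤ : ∀ {b l} → All (_≤ b) l → ∀ i → row l i ≤ b
row-≤ []       i             = z≤n
row-≤ (_ ∷ _)  zero          = z≤n
row-≤ (p ∷ _)  (suc zero)    = p
row-≤ (_ ∷ ps) (suc (suc i)) = row-≤ ps (suc i)

row-positive : ∀ {l} → All (0 <_) l → ∀ {i} → 1 ≤ i → i ≤ length l → 0 < row l i
row-positive (p ∷ _)  {suc zero}    _ _         = p
row-positive (_ ∷ ps) {suc (suc i)} _ (s≤s i≤l) = row-positive ps (s≤s z≤n) i≤l

row-antitone : ∀ {l} → Linked _≥_ l → ∀ {i k} → 1 ≤ i → i ≤ k → row l k ≤ row l i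
row-antitone {[]}    _   _ _ = z≤n
row-antitone {_ ∷ _} dec {suc zero}    {k}           _ _         = row-≤ (head-bounds dec) k
row-antitone {_ ∷ _} dec {suc (suc i)} {suc (suc k)} _ (s≤s i≤k) =
  row-antitone (tail dec) (s≤s z≤n) i≤k

row-map-suc-++ : ∀ l {L i} → 1 ≤ i → i ≤ length l → row (map suc l ++ L) i ≡ suc (row l i)
row-map-suc-++ (_ ∷ _) {i = suc zero}    _ _         = refl
row-map-suc-++ (_ ∷ l) {i = suc (suc i)} _ (s≤s i≤l) = row-map-suc-++ l (s≤s z≤n) i≤l

row-map-suc-++-beyond : ∀ l {L i} → length l < i → row (map suc l ++ L) i ≡ row L (i ∸ length l)
row-map-suc-++-beyond []      _              = refl
row-map-suc-++-beyond (_ ∷ l) {i = suc (suc i)} (s≤s l<i) = row-map-suc-++-beyond l l<i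

col-∷-≤ : ∀ {j x} l → j ≤ x → col (x ∷ l) j ≡ suc (col l j)
col-∷-≤ {j} _ j≤x = cong length (filter-accept (j ≤?_) j≤x)

col-∷-≰ : ∀ {j x} l → ¬ j ≤ x → col (x ∷ l) j ≡ col l j
col-∷-≰ {j} _ j≰x = cong length (filter-reject (j ≤?_) j≰x)

col-positive : ∀ {j x} l → j ≤ x → 0 < col (x ∷ l) j
col-positive l j≤x = subst (0 <_) (sym (col-∷-≤ l j≤x)) (s≤s z≤n)

col-length : ∀ {l} → All (0 <_) l → col l 1 ≡ length l
col-length ps = cong length (filter-all (1 ≤?_) ps)

col-beyond : ∀ {b l j} → All (_≤ b) l → b < j → col l j ≡ 0
col-beyond {j = j} ps b<j =
  cong length (filter-none (j ≤?_) (All.map (λ x≤b j≤x → <⇒≱ b<j (≤-trans j≤x x≤b)) ps))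

col-++ : ∀ xs ys j → col (xs ++ ys) j ≡ col xs j + col ys j
col-++ xs ys j = trans (cong length (filter-++ (j ≤?_) xs ys)) (length-++ (filter (j ≤?_) xs))

col-map-suc : ∀ l j → col (map suc l) (suc j) ≡ col l j
col-map-suc []      j = refl
col-map-suc (x ∷ l) j with j ≤? x
... | yes j≤x = trans (col-∷-≤ (map suc l) (s≤s j≤x))
                      (trans (cong suc (col-map-suc l j)) (sym (col-∷-≤ l j≤x)))
... | no  j≰x = trans (col-∷-≰ (map suc l) (λ sj≤sx → j≰x (s≤s⁻¹ sj≤sx)))
                      (trans (col-map-suc l j) (sym (col-∷-≰ l j≰x)))

∤-small : ∀ {t n} → 0 < n → n < t → t ∤ n
∤-small {n = suc _} _ n<t = >⇒∤ n<t

∤-+-∣ : ∀ {t n k} → t ∤ n → t ∣ k → t ∤ n + k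
∤-+-∣ {t} {n} {k} t∤n t∣k t∣n+k = t∤n (∣m+n∣m⇒∣n (subst (t ∣_) (+-comm n k) t∣n+k) t∣k)

+-suc-∸-suc : ∀ {a j} c → j ≤ a → a + suc c ∸ suc j ≡ (a ∸ j) + c
+-suc-∸-suc {a} {j} c j≤a = trans (cong (_∸ suc j) (+-suc a c)) (+-∸-comm c j≤a)

shift-into-arm : ∀ a k {b} → 0 < b → a + k + b + 1 ≡ a + (b ∸ 1) + 1 + suc k
shift-into-arm a k {suc b} _ = identity a k b
  where
  identity : ∀ a k b → a + k + suc b + 1 ≡ a + b + 1 + suc k
  identity = solve-∀

shift-into-leg : ∀ {a} b k → 0 < a → a + (b + k) + 1 ≡ (a ∸ 1) + b + 1 + suc k
shift-into-leg {suc a} b k _ = identity a b k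
  where
  identity : ∀ a b k → suc a + (b + k) + 1 ≡ a + b + 1 + suc k
  identity = solve-∀

-- The hook of a new cell past the end of the old first row (a = μ₁) or column (a = ℓ(μ)).
tail-hook-∤ : ∀ {a i c} → 1 ≤ c → a < i → suc c ∤ (a + c ∸ i) + 1
tail-hook-∤ {a} {i} {suc c} _ a<i = ∤-small (m≤n+m 1 _) (s≤s bound)
  where
  open ≤-Reasoning
  bound : (a + suc c ∸ i) + 1 ≤ suc c
  bound = begin
    (a + suc c ∸ i) + 1   ≤⟨ +-monoˡ-≤ 1 (∸-monoʳ-≤ (a + suc c) a<i) ⟩
    (a + suc c ∸ suc a) + 1 ≡⟨ cong (_+ 1) (trans (cong (_∸ suc a) (+-suc a c)) (m+n∸m≡n a c)) ⟩
    c + 1                 ≡⟨ +-comm c 1 ⟩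
    suc c                 ∎

-- With t = c + 1, grow μ has Frobenius coordinates (α₁ + t, α₁, α₂, … ∣ β₁ + t, β₁, β₂, …)
-- when μ has (α₁, α₂, … ∣ β₁, β₂, …); the empty partition is left alone.
grow : ℕ → List ℕ → List ℕ
grow c []      = []
grow c (h ∷ r) = (h + suc c) ∷ (map suc (h ∷ r) ++ replicate c 1)

AllFrobenius : (ℕ → ℕ → Set) → List ℕ → Set
AllFrobenius R μ = ∀ i → 1 ≤ i → i ≤ row μ i → R (frobα μ i) (frobβ μ i)

ShiftInvariant : (ℕ → ℕ → Set) → Set
ShiftInvariant R = ∀ {a b} k → R a b → R (a + k) (b + k)

module _ (c h : ℕ) (r : List ℕ) where

  private
    μ ν : List ℕ
    μ = h ∷ r
    ν = grow c μ

  length-grow : length ν ≡ suc (length μ + c)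
  length-grow =
    cong suc (trans (length-++ (map suc μ)) (cong₂ _+_ (length-map suc μ) (length-replicate c)))

  grow-positive : All (0 <_) ν
  grow-positive =
    ≤-trans (s≤s z≤n) (m≤n+m (suc c) h)
    ∷ ++⁺ (map⁺ (All.universal (λ _ → s≤s z≤n) μ)) (replicate⁺ c (s≤s z≤n))

  grow-decreasing : Linked _≥_ μ → Linked _≥_ ν
  grow-decreasing dec = m<m+n h (s≤s z≤n) ∷ shifted c dec
    where
    ones : ∀ n → Linked _≥_ (replicate n 1)
    ones zero          = []
    ones (suc zero)    = [-]
    ones (suc (suc n)) = ≤-refl ∷ ones (suc n)
    shifted : ∀ n {x l} → Linked _≥_ (x ∷ l) → Linked _≥_ (map suc (x ∷ l) ++ replicate n 1)
    shifted zero    {l = []}    [-]          = [-]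
    shifted (suc n) {l = []}    [-]          = s≤s z≤n ∷ ones (suc n)
    shifted n       {l = _ ∷ _} (y≤x ∷ dec′) = s≤s y≤x ∷ shifted n dec′

  row-grow-suc : ∀ {i} → 1 ≤ i → i ≤ length μ → row ν (suc i) ≡ suc (row μ i)
  row-grow-suc {suc _} _ i≤m = row-map-suc-++ μ (s≤s z≤n) i≤m

  row-grow-beyond : ∀ {i} → length μ < i → row ν (suc i) ≤ 1
  row-grow-beyond {suc i} m<i =
    subst (_≤ 1) (sym (row-map-suc-++-beyond μ m<i)) (row-≤ (replicate⁺ c ≤-refl) _)

  row-grow-tall : ∀ {i} → 2 ≤ row ν (suc i) → i ≤ length μ
  row-grow-tall tall = ≮⇒≥ (λ m<i → <⇒≱ tall (row-grow-beyond m<i))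

  col-grow-suc : ∀ {j} → 1 ≤ j → suc j ≤ row ν 1 → col ν (suc j) ≡ suc (col μ j)
  col-grow-suc {suc j} _ j<x = begin
    col ν (suc (suc j))
      ≡⟨ col-∷-≤ (map suc μ ++ replicate c 1) j<x ⟩
    suc (col (map suc μ ++ replicate c 1) (suc (suc j)))
      ≡⟨ cong suc (col-++ (map suc μ) (replicate c 1) (suc (suc j))) ⟩
    suc (col (map suc μ) (suc (suc j)) + col (replicate c 1) (suc (suc j)))
      ≡⟨ cong suc (cong₂ _+_ (col-map-suc μ (suc j))
                              (col-beyond (replicate⁺ c ≤-refl) (s≤s (s≤s z≤n)))) ⟩
    suc (col μ (suc j) + 0)
      ≡⟨ cong suc (+-identityʳ _) ⟩
    suc (col μ (suc j)) ∎
    where open ≡-Reasoning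

  col-grow-one : All (0 <_) μ → col ν 1 ≡ col μ 1 + suc c
  col-grow-one pos = begin
    col ν 1                ≡⟨ col-length grow-positive ⟩
    length ν               ≡⟨ length-grow ⟩
    suc (length μ + c)     ≡⟨ +-suc (length μ) c ⟨
    length μ + suc c       ≡⟨ cong (_+ suc c) (col-length pos) ⟨
    col μ 1 + suc c        ∎
    where open ≡-Reasoning

  module _ (μ-positive : All (0 <_) μ) (μ-decreasing : Linked _≥_ μ) where

    private
      h-positive : 0 < h
      h-positive = All.head μ-positive

      row-<-first-row : ∀ i → row μ i < row ν 1
      row-<-first-row i = ≤-trans (s≤s (row-≤ (head-bounds μ-decreasing) i)) (m<m+n h (s≤s z≤n))

      unshift-cell : ∀ {i j} → 1 ≤ j → suc j ≤ row ν (suc (suc i)) →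
                     suc i ≤ length μ × j ≤ row μ (suc i) × suc j ≤ row ν 1
      unshift-cell {i} j≥1 j<row = i<m , j≤row , ≤-trans (s≤s j≤row) (row-<-first-row (suc i))
        where
        i<m = row-grow-tall (≤-trans (s≤s j≥1) j<row)
        j≤row = s≤s⁻¹ (subst (_ ≤_) (row-grow-suc (s≤s z≤n) i<m) j<row)

    frobα-grow-one : frobα ν 1 ≡ frobα μ 1 + suc c
    frobα-grow-one = +-∸-comm (suc c) h-positive

    frobβ-grow-one : frobβ ν 1 ≡ frobβ μ 1 + suc c
    frobβ-grow-one = trans (cong (_∸ 1) (col-grow-one μ-positive))
                           (+-∸-comm (suc c) (col-positive r h-positive))

    hook-grow-corner : hook ν 1 1 ≡ hook μ 1 1 + (suc c + suc c)
    hook-grow-corner = trans (cong₂ (λ a b → a + b + 1) frobα-grow-one frobβ-grow-one)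
                             (identity (frobα μ 1) (frobβ μ 1) (suc c))
      where
      identity : ∀ a b t → a + t + (b + t) + 1 ≡ a + b + 1 + (t + t)
      identity = solve-∀

    hook-grow-first-row : ∀ {j} → 1 ≤ j → j ≤ h → hook ν 1 (suc j) ≡ hook μ 1 j + suc c
    hook-grow-first-row {j} j≥1 j≤h = begin
      (h + suc c ∸ suc j) + (col ν (suc j) ∸ 1) + 1
        ≡⟨ cong₂ (λ a b → a + (b ∸ 1) + 1) (+-suc-∸-suc c j≤h)
                 (col-grow-suc j≥1 (≤-trans (s≤s j≤h) (row-<-first-row 1))) ⟩
      (h ∸ j) + c + col μ j + 1
        ≡⟨ shift-into-arm (h ∸ j) c (col-positive r j≤h) ⟩
      (h ∸ j) + (col μ j ∸ 1) + 1 + suc c ∎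
      where open ≡-Reasoning

    hook-grow-first-col : ∀ {i} → 1 ≤ i → i ≤ length μ → hook ν (suc i) 1 ≡ hook μ i 1 + suc c
    hook-grow-first-col {i} i≥1 i≤m = begin
      (row ν (suc i) ∸ 1) + (col ν 1 ∸ suc i) + 1
        ≡⟨ cong₂ (λ a b → (a ∸ 1) + (b ∸ suc i) + 1)
                 (row-grow-suc i≥1 i≤m) (col-grow-one μ-positive) ⟩
      row μ i + (col μ 1 + suc c ∸ suc i) + 1
        ≡⟨ cong (λ b → row μ i + b + 1)
                (+-suc-∸-suc c (subst (i ≤_) (sym (col-length μ-positive)) i≤m)) ⟩
      row μ i + ((col μ 1 ∸ i) + c) + 1
        ≡⟨ shift-into-leg (col μ 1 ∸ i) c (row-positive μ-positive i≥1 i≤m) ⟩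
      (row μ i ∸ 1) + (col μ 1 ∸ i) + 1 + suc c ∎
      where open ≡-Reasoning

    hook-grow-inner : ∀ {i j} → 1 ≤ i → i ≤ length μ → 1 ≤ j → suc j ≤ row ν 1 →
                      hook ν (suc i) (suc j) ≡ hook μ i j
    hook-grow-inner {i} {j} i≥1 i≤m j≥1 j<x =
      cong₂ (λ a b → (a ∸ suc j) + (b ∸ suc i) + 1) (row-grow-suc i≥1 i≤m) (col-grow-suc j≥1 j<x)

    hook-grow-first-row-tail : ∀ {j} → h < j → suc j ≤ row ν 1 → hook ν 1 (suc j) ≡ (h + c ∸ j) + 1
    hook-grow-first-row-tail {j} h<j j<x = begin
      (h + suc c ∸ suc j) + (col ν (suc j) ∸ 1) + 1
        ≡⟨ cong₂ (λ a b → a + (b ∸ 1) + 1) (cong (_∸ suc j) (+-suc h c))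
                 (trans (col-grow-suc (≤-trans (s≤s z≤n) h<j) j<x)
                        (cong suc (col-beyond (head-bounds μ-decreasing) h<j))) ⟩
      (h + c ∸ j) + 0 + 1
        ≡⟨ cong (_+ 1) (+-identityʳ _) ⟩
      (h + c ∸ j) + 1 ∎
      where open ≡-Reasoning

    hook-grow-first-col-tail : ∀ {i} → length μ < i → hook ν (suc i) 1 ≡ (length μ + c ∸ i) + 1
    hook-grow-first-col-tail {i} m<i = begin
      (row ν (suc i) ∸ 1) + (col ν 1 ∸ suc i) + 1
        ≡⟨ cong₂ (λ a b → a + (b ∸ suc i) + 1) (m≤n⇒m∸n≡0 (row-grow-beyond m<i))
                 (trans (col-grow-one μ-positive) (cong (_+ suc c) (col-length μ-positive))) ⟩
      (length μ + suc c ∸ suc i) + 1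
        ≡⟨ cong (λ b → (b ∸ suc i) + 1) (+-suc (length μ) c) ⟩
      (length μ + c ∸ i) + 1 ∎
      where open ≡-Reasoning

    grow-core : 1 ≤ c → IsCore (suc c) μ → IsCore (suc c) ν
    grow-core _ _ zero _ (() , _)
    grow-core _ _ (suc _) zero (_ , () , _)
    grow-core _ core 1 1 _ =
      subst (suc c ∤_) (sym hook-grow-corner)
            (∤-+-∣ (core 1 1 (≤-refl , ≤-refl , h-positive)) (∣m∣n⇒∣m+n ∣-refl ∣-refl))
    grow-core c≥1 core 1 (suc (suc j)) (_ , _ , j<x) with suc j ≤? h
    ... | yes j≤h = subst (suc c ∤_) (sym (hook-grow-first-row (s≤s z≤n) j≤h))
                          (∤-+-∣ (core 1 (suc j) (≤-refl , s≤s z≤n , j≤h)) ∣-refl)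
    ... | no  j≰h = subst (suc c ∤_) (sym (hook-grow-first-row-tail (≰⇒> j≰h) j<x))
                          (tail-hook-∤ c≥1 (≰⇒> j≰h))
    grow-core c≥1 core (suc (suc i)) 1 _ with suc i ≤? length μ
    ... | yes i≤m = subst (suc c ∤_) (sym (hook-grow-first-col (s≤s z≤n) i≤m))
                          (∤-+-∣ (core (suc i) 1 (s≤s z≤n , ≤-refl , row-positive μ-positive (s≤s z≤n) i≤m))
                                 ∣-refl)
    ... | no  i≰m = subst (suc c ∤_) (sym (hook-grow-first-col-tail (≰⇒> i≰m)))
                          (tail-hook-∤ c≥1 (≰⇒> i≰m))
    grow-core _ core (suc (suc i)) (suc (suc j)) (_ , _ , j<row)
      with i<m , j≤row , j<x ← unshift-cell {i} (s≤s z≤n) j<row =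
      subst (suc c ∤_) (sym (hook-grow-inner (s≤s z≤n) i<m (s≤s z≤n) j<x))
            (core (suc i) (suc j) (s≤s z≤n , s≤s z≤n , j≤row))

    grow-frobenius : ∀ {R} → ShiftInvariant R → AllFrobenius R μ → AllFrobenius R ν
    grow-frobenius {R} shift frob 1 _ _ =
      subst₂ R (sym frobα-grow-one) (sym frobβ-grow-one) (shift (suc c) (frob 1 ≤-refl h-positive))
    grow-frobenius {R} shift frob (suc (suc i)) _ i<row
      with i<m , i≤row , i<x ← unshift-cell {i} (s≤s z≤n) i<row =
      subst₂ R (cong (_∸ suc (suc i)) (sym (row-grow-suc (s≤s z≤n) i<m)))
               (cong (_∸ suc (suc i)) (sym (col-grow-suc (s≤s z≤n) i<x)))
               (frob (suc i) (s≤s z≤n) i≤row)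

grow-lengthens : ∀ c μ → 0 < length μ → length μ < length (grow c μ)
grow-lengthens c (h ∷ r) _ =
  subst (length (h ∷ r) <_) (sym (length-grow c h r)) (s≤s (m≤m+n _ c))

FrobeniusCore : ℕ → (ℕ → ℕ → Set) → List ℕ → Set
FrobeniusCore t R μ = IsPartition μ × AllFrobenius R μ × IsCore t μ

grow-preserves : ∀ {c R} → 1 ≤ c → ShiftInvariant R →
                 ∀ μ → FrobeniusCore (suc c) R μ → FrobeniusCore (suc c) R (grow c μ)
grow-preserves _ _ [] good = good
grow-preserves {c} {R} c≥1 shift (h ∷ r) ((pos , dec) , frob , core) =
  (grow-positive c h r , grow-decreasing c h r dec) ,
  grow-frobenius c h r pos dec {R} shift frob ,
  grow-core c h r pos dec c≥1 core

FrobeniusUpToRank : (ℕ → ℕ → Set) → List ℕ → Set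
FrobeniusUpToRank R μ = ∀ k → IsRank μ k → ∀ i → 1 ≤ i → i ≤ k → R (frobα μ i) (frobβ μ i)

AllFrobenius⇒UpToRank : ∀ {R μ} → IsPartition μ → AllFrobenius R μ → FrobeniusUpToRank R μ
AllFrobenius⇒UpToRank _ _ k (inj₁ refl , _) i i≥1 i≤k = ⊥-elim (<⇒≱ i≥1 i≤k)
AllFrobenius⇒UpToRank (_ , dec) frob k (inj₂ k≤row , _) i i≥1 i≤k =
  frob i i≥1 (≤-trans i≤k (≤-trans k≤row (row-antitone dec i≥1 i≤k)))

OneMore : ℕ → ℕ → Set
OneMore a b = b ≡ a + 1

oneMore-shift : ShiftInvariant OneMore
oneMore-shift {a} k refl = identity a k
  where
  identity : ∀ a k → a + 1 + k ≡ a + k + 1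
  identity = solve-∀

∈⇒length≤ : ∀ {ν : List ℕ} L → ν ∈ L → length ν ≤ sum (map length L)
∈⇒length≤ (ν ∷ L) (here refl) = m≤m+n (length ν) _
∈⇒length≤ (μ ∷ L) (there ν∈L) = ≤-trans (∈⇒length≤ L ν∈L) (m≤n+m _ (length μ))

module _ {Q : List ℕ → Set} {f : List ℕ → List ℕ}
         (f-preserves : ∀ μ → Q μ → Q (f μ))
         (f-lengthens : ∀ μ → 0 < length μ → length μ < length (f μ)) where

  private
    iterate-preserves : ∀ n {μ} → Q μ → Q (iterate f μ n)
    iterate-preserves zero    q = q
    iterate-preserves (suc n) q = iterate-preserves n (f-preserves _ q)

    iterate-lengthens : ∀ n {μ} → 0 < length μ → n + length μ ≤ length (iterate f μ n)
    iterate-lengthens zero    _ = ≤-refl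
    iterate-lengthens (suc n) {μ} μ≢[] = begin
      suc n + length μ           ≡⟨ +-suc n (length μ) ⟨
      n + suc (length μ)         ≤⟨ +-monoʳ-≤ n (f-lengthens μ μ≢[]) ⟩
      n + length (f μ)           ≤⟨ iterate-lengthens n (<-trans μ≢[] (f-lengthens μ μ≢[])) ⟩
      length (iterate f (f μ) n) ∎
      where open ≤-Reasoning

  infinitely-many : ∀ {μ} → Q μ → 0 < length μ → (L : List (List ℕ)) → ∃[ ν ] (Q ν × ν ∉ L)
  infinitely-many {μ} q μ≢[] L = iterate f μ n , iterate-preserves n q , λ ν∈L →
    <⇒≱ (≤-trans (m≤m+n n (length μ)) (iterate-lengthens n μ≢[])) (∈⇒length≤ L ν∈L)
    where n = suc (sum (map length L))

infinitely-many-cores :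
  ∀ {c R μ} → 1 ≤ c → ShiftInvariant R → FrobeniusCore (suc c) R μ → 0 < length μ →
  (L : List (List ℕ)) → ∃[ ν ] ((IsPartition ν × FrobeniusUpToRank R ν × IsCore (suc c) ν) × ν ∉ L)
infinitely-many-cores {c} {R} c≥1 shift seed seed≢[] L
  with ν , (partition , frob , core) , ν∉L
         ← infinitely-many (grow-preserves {R = R} c≥1 shift) (grow-lengthens c) seed seed≢[] L
  = ν , (partition , AllFrobenius⇒UpToRank {R} partition frob , core) , ν∉L

symplectic-seed : ∀ {t} → 3 ≤ t → FrobeniusCore t OneMore (1 ∷ 1 ∷ [])
symplectic-seed {t} t≥3 = ((s≤s z≤n ∷ s≤s z≤n ∷ []) , ≤-refl ∷ [-]) , frob , core
  where
  frob : AllFrobenius OneMore (1 ∷ 1 ∷ [])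
  frob 1                   _ _       = refl
  frob (suc (suc zero))    _ (s≤s ())
  frob (suc (suc (suc _))) _ ()
  core : IsCore t (1 ∷ 1 ∷ [])
  core zero                _             (() , _)
  core (suc _)             zero          (_ , () , _)
  core 1                   1             _ = ∤-small (s≤s z≤n) t≥3
  core 2                   1             _ = ∤-small (s≤s z≤n) (≤-trans (s≤s (s≤s z≤n)) t≥3)
  core 1                   (suc (suc _)) (_ , _ , s≤s ())
  core 2                   (suc (suc _)) (_ , _ , s≤s ())
  core (suc (suc (suc _))) (suc _)       (_ , _ , ())

orthogonal-seed : ∀ {t} → 3 ≤ t → FrobeniusCore t (flip OneMore) (2 ∷ [])
orthogonal-seed {t} t≥3 = ((s≤s z≤n ∷ []) , [-]) , frob , core
  where
  frob : AllFrobenius (flip OneMore) (2 ∷ [])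
  frob 1             _ _ = refl
  frob (suc (suc _)) _ ()
  core : IsCore t (2 ∷ [])
  core zero          _                   (() , _)
  core (suc _)       zero                (_ , () , _)
  core 1             1                   _ = ∤-small (s≤s z≤n) t≥3
  core 1             2                   _ = ∤-small (s≤s z≤n) (≤-trans (s≤s (s≤s z≤n)) t≥3)
  core 1             (suc (suc (suc _))) (_ , _ , s≤s (s≤s ()))
  core (suc (suc _)) (suc _)             (_ , _ , ())

theorem2p21 : ∀ (t : ℕ) → 3 ≤ t →
    ((L : List (List ℕ)) → ∃[ μ ] (SymplecticCore t μ × μ ∉ L))
    × ((L : List (List ℕ)) → ∃[ μ ] (OrthogonalCore t μ × μ ∉ L))
theorem2p21 (suc c) t≥3@(s≤s c≥2) =
  infinitely-many-cores {R = OneMore} c≥1 oneMore-shift (symplectic-seed t≥3) (s≤s z≤n) ,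
  infinitely-many-cores {R = flip OneMore} c≥1 oneMore-shift (orthogonal-seed t≥3) (s≤s z≤n)
  where
  c≥1 : 1 ≤ c
  c≥1 = ≤-trans (s≤s z≤n) c≥2
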